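{- For all terms $M, M', L, N$: (1) If $M\to_{h\sigma} L\to_{h\beta_v} N$, then there exists a term $L'$ such that $M\to_{h\beta_v} L'$ and ($L'\to_{h\sigma}N$ or $L'=N$). (2) If $M\to_{h\sigma}^* L\to_{h\beta_v}^* N$, then there exists a term $L'$ such that $M\to_{h\beta_v}^* L'\to_{h\sigma}^* N$. (3) If $M\to_h^* M'$, then there exists a term $N$ such that $M\to_{h\beta_v}^* N\to_{h\sigma}^* M'$.
   Context: Terms and values of the call-by-value $\lambda$-calculus are defined by mutual induction from a countably infinite set of variables: values $V ::= x \mid \lambda x.M$ and terms $M,N,L ::= V \mid MN$, up to $\alpha$-conversion, application associating to the left; $\mathrm{fv}(M)$ is the set of free variables and $M\{V/x\}$ capture-avoiding substitution of a value. $^*$ denotes reflexive-transitive closure. Head $\beta_v$-reduction $\to_{h\beta_v}$ is the least relation with: $(\lambda x.M)V M_1\dots M_m \to_{h\beta_v} M\{V/x\}M_1\dots M_m$ ($V$ value, $m\ge0$); if $N\to_{h\beta_v}N'$ then $VNM_1\dots M_m\to_{h\beta_v}VN'M_1\dots M_m$ ($V$ value, $m\ge0$). Head $\sigma$-reduction $\to_{h\sigma}$ is the least relation with: $(\lambda x.M)NLM_1\dots M_m\to_{h\sigma}(\lambda x.ML)NM_1\dots M_m$ ($x\notin\mathrm{fv}(L)$); $V((\lambda x.L)N)M_1\dots M_m\to_{h\sigma}(\lambda x.VL)NM_1\dots M_m$ ($V$ value, $x\notin\mathrm{fv}(V)$); if $N\to_{h\sigma}N'$ then $VNM_1\dots M_m\to_{h\sigma}VN'M_1\dots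 M_m$ ($V$ value); $m\ge 0$ throughout. $\to_h=\to_{h\beta_v}\cup\to_{h\sigma}$. -}

module Defs where

open import Data.Nat using (ℕ; zero; suc)
open import Data.List using (List; []; _∷_)
open import Relation.Binary.Construct.Closure.ReflexiveTransitive using (Star) public

-- Terms of the λ-calculus up to α-conversion: de Bruijn indices.
data Term : Set where
  var : ℕ → Term
  lam : Term → Term
  app : Term → Term → Term

data Value : Term → Set where
  v-var : ∀ {n} → Value (var n)
  v-lam : ∀ {M} → Value (lam M)

ext : (ℕ → ℕ) → ℕ → ℕ
ext ρ zero    = zero
ext ρ (suc n) = suc (ρ n)

rename : (ℕ → ℕ) → Term → Term
rename ρ (var n)   = var (ρ n)
rename ρ (lam M)   = lam (rename (ext ρ) M)
rename ρ (app M N) = app (rename ρ M) (rename ρ N)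

-- Weakening: the term seen under one extra binder whose variable
-- does not occur in it (this encodes the side condition x ∉ fv(·)).
shift : Term → Term
shift = rename suc

exts : (ℕ → Term) → ℕ → Term
exts σ zero    = var zero
exts σ (suc n) = shift (σ n)

subst : (ℕ → Term) → Term → Term
subst σ (var n)   = σ n
subst σ (lam M)   = lam (subst (exts σ) M)
subst σ (app M N) = app (subst σ M) (subst σ N)

-- M{V/x}, where x is the variable bound by the enclosing λ (index 0).
single : Term → ℕ → Term
single V zero    = V
single V (suc n) = var n

_[_] : Term → Term → Term
M [ V ] = subst (single V) M

_·⋆_ : Term → List Term → Term
M ·⋆ []       = M
M ·⋆ (N ∷ Ns) = app M N ·⋆ Ns

infixl 5 _·⋆_

data _→hβ_ : Term → Term → Set where
  hβ-β   : ∀ {M V} (Ms : List Term) → Value V →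
           (app (lam M) V ·⋆ Ms) →hβ (M [ V ] ·⋆ Ms)
  hβ-arg : ∀ {V N N'} (Ms : List Term) → Value V → N →hβ N' →
           (app V N ·⋆ Ms) →hβ (app V N' ·⋆ Ms)

data _→hσ_ : Term → Term → Set where
  hσ-1   : ∀ {M N L} (Ms : List Term) →
           (app (app (lam M) N) L ·⋆ Ms) →hσ (app (lam (app M (shift L))) N ·⋆ Ms)
  hσ-3   : ∀ {V L N} (Ms : List Term) → Value V →
           (app V (app (lam L) N) ·⋆ Ms) →hσ (app (lam (app (shift V) L)) N ·⋆ Ms)
  hσ-arg : ∀ {V N N'} (Ms : List Term) → Value V → N →hσ N' →
           (app V N ·⋆ Ms) →hσ (app V N' ·⋆ Ms)

data _→h_ : Term → Term → Set where
  h-β : ∀ {M N} → M →hβ N → M →h N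
  h-σ : ∀ {M N} → M →hσ N → M →h N

_→hβ*_ : Term → Term → Set
_→hβ*_ = Star _→hβ_

_→hσ*_ : Term → Term → Set
_→hσ*_ = Star _→hσ_

_→h*_ : Term → Term → Set
_→h*_ = Star _→h_

module Submission where

-- The heart of the proof is the one-step commutation (1): a head σ-step
-- followed by a head βv-step can be replaced by a head βv-step followed by
-- at most one head σ-step.  It is proved by induction on the σ-step, after
-- inverting the βv-step with a "view" of how a βv-step can start from a
-- term of the shape  V A M₁ … Mₘ  (the redex fires, or the argument A
-- reduces).  Inverting needs (a) that a head-value spine  V M₁ … Mₘ
-- determines V and the Mᵢ, and (b) that σ-reducts are never values; the
-- βv-redex cases additionally need that substituting into a shifted term
-- has no effect.  Iterating (1) along a βv-sequence moves one σ-step past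
-- it; induction on the σ-sequence then gives (2); (3) follows from (2) by
-- induction on the mixed sequence, pushing each σ-step to the right.

open import Defs
open import Data.Empty using (⊥; ⊥-elim)
open import Data.List using (List; []; _∷_; _++_)
open import Data.List.Properties using (++-assoc; ++-identityʳ)
open import Data.Nat using (ℕ; zero; suc)
open import Data.Product using (_×_; ∃-syntax; _,_; proj₁; proj₂)
open import Data.Sum using (_⊎_; inj₁; inj₂)
open import Relation.Binary.Construct.Closure.ReflexiveTransitive using (ε; _◅_; _◅◅_)
open import Relation.Binary.PropositionalEquality
  using (_≡_; refl; cong; cong₂; sym; trans)

subst-rename : ∀ {σ τ : ℕ → Term} {ρ : ℕ → ℕ} →
               (∀ n → σ (ρ n) ≡ τ n) → ∀ M → subst σ (rename ρ M) ≡ subst τ M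
subst-rename h (var n)   = h n
subst-rename {σ} {τ} {ρ} h (lam M) = cong lam (subst-rename exts-ext M)
  where
  exts-ext : ∀ n → exts σ (ext ρ n) ≡ exts τ n
  exts-ext zero    = refl
  exts-ext (suc n) = cong shift (h n)
subst-rename h (app M N) = cong₂ app (subst-rename h M) (subst-rename h N)

subst-id : ∀ {σ : ℕ → Term} → (∀ n → σ n ≡ var n) → ∀ M → subst σ M ≡ M
subst-id h (var n)   = h n
subst-id {σ} h (lam M) = cong lam (subst-id exts-id M)
  where
  exts-id : ∀ n → exts σ n ≡ var n
  exts-id zero    = refl
  exts-id (suc n) = cong shift (h n)
subst-id h (app M N) = cong₂ app (subst-id h M) (subst-id h N)

-- L{V/x} = L when x ∉ fv(L): this is what makes the βv-redex created by a
-- σ-step contract to the same term as the original redex.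
shift-[] : ∀ L V → shift L [ V ] ≡ L
shift-[] L V = trans (subst-rename {τ = var} (λ _ → refl) L) (subst-id (λ _ → refl) L)

spine : Term → Term × List Term
spine (app M N) = proj₁ (spine M) , proj₂ (spine M) ++ (N ∷ [])
spine M         = M , []

spine-·⋆ : ∀ M Ns → spine (M ·⋆ Ns) ≡ (proj₁ (spine M) , proj₂ (spine M) ++ Ns)
spine-·⋆ M []       = cong (proj₁ (spine M) ,_) (sym (++-identityʳ _))
spine-·⋆ M (N ∷ Ns) = trans (spine-·⋆ (app M N) Ns)
  (cong (proj₁ (spine M) ,_) (++-assoc (proj₂ (spine M)) (N ∷ []) Ns))

spine-value : ∀ {V} → Value V → ∀ Ns → spine (V ·⋆ Ns) ≡ (V , Ns)
spine-value {V} v-var Ns = spine-·⋆ V Ns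
spine-value {V} v-lam Ns = spine-·⋆ V Ns

·⋆-injective : ∀ {V V' Ns Ns'} → Value V → Value V' →
               V ·⋆ Ns ≡ V' ·⋆ Ns' → V ≡ V' × Ns ≡ Ns'
·⋆-injective {Ns = Ns} {Ns'} v v' eq
  with trans (sym (spine-value v Ns)) (trans (cong spine eq) (spine-value v' Ns'))
... | refl = refl , refl

data HβView (V A : Term) (Ms : List Term) : Term → Set where
  fires  : ∀ {X} → V ≡ lam X → Value A → HβView V A Ms (X [ A ] ·⋆ Ms)
  in-arg : ∀ {A'} → A →hβ A' → HβView V A Ms (app V A' ·⋆ Ms)

hβ-view : ∀ {V A Ms N} → Value V → (app V A ·⋆ Ms) →hβ N → HβView V A Ms N
hβ-view {V} {A} {Ms} vV = view refl
  where
  view : ∀ {T N} → T ≡ app V A ·⋆ Ms → T →hβ N → HβView V A Ms N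
  view eq (hβ-β {M} {W} Ms' vW)
    with ·⋆-injective {Ns = W ∷ Ms'} {Ns' = A ∷ Ms} (v-lam {M}) vV eq
  ... | refl , refl = fires refl vW
  view eq (hβ-arg {N = B} Ms' vW step)
    with ·⋆-injective {Ns = B ∷ Ms'} {Ns' = A ∷ Ms} vW vV eq
  ... | refl , refl = in-arg step

·⋆-app-not-value : ∀ M N Ms → Value (app M N ·⋆ Ms) → ⊥
·⋆-app-not-value M N []       ()
·⋆-app-not-value M N (L ∷ Ms) v = ·⋆-app-not-value (app M N) L Ms v

hσ-reduct-not-value : ∀ {M N} → M →hσ N → Value N → ⊥
hσ-reduct-not-value (hσ-1 Ms)       = ·⋆-app-not-value _ _ Ms
hσ-reduct-not-value (hσ-3 Ms _)     = ·⋆-app-not-value _ _ Ms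
hσ-reduct-not-value (hσ-arg Ms _ _) = ·⋆-app-not-value _ _ Ms

-- In the σ-rule cases the βv-step either contracts the redex
-- that the σ-step created (and then βv reaches N directly), or reduces
-- inside N₀ (and the σ-step is replayed).  In the congruence case the
-- βv-step cannot fire, since the σ-reduct in argument position is no value.
σβ-commute : ∀ {M L N} → M →hσ L → L →hβ N → ∃[ L' ] (M →hβ L' × (L' →hσ N ⊎ L' ≡ N))
σβ-commute (hσ-1 {M₀} {N₀} {L₀} Ms) step
  with hβ-view {lam (app M₀ (shift L₀))} {N₀} {Ms} v-lam step
... | fires refl vN₀ = _ , hβ-β (L₀ ∷ Ms) vN₀ ,
  inj₂ (cong (λ L → app (M₀ [ N₀ ]) L ·⋆ Ms) (sym (shift-[] L₀ N₀)))
... | in-arg stepN₀ = _ , hβ-arg (L₀ ∷ Ms) v-lam stepN₀ , inj₁ (hσ-1 Ms)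
σβ-commute (hσ-3 {V} {L₀} {N₀} Ms vV) step
  with hβ-view {lam (app (shift V) L₀)} {N₀} {Ms} v-lam step
... | fires refl vN₀ = _ , hβ-arg Ms vV (hβ-β [] vN₀) ,
  inj₂ (cong (λ W → app W (L₀ [ N₀ ]) ·⋆ Ms) (sym (shift-[] V N₀)))
... | in-arg stepN₀ = _ , hβ-arg Ms vV (hβ-arg [] v-lam stepN₀) , inj₁ (hσ-3 Ms vV)
σβ-commute (hσ-arg {V} {N' = N'} Ms vV σ-step) step with hβ-view {V} {N'} {Ms} vV step
... | fires refl vN' = ⊥-elim (hσ-reduct-not-value σ-step vN')
... | in-arg stepN' with σβ-commute σ-step stepN'
...   | _ , β-step , inj₁ σ-step' = _ , hβ-arg Ms vV β-step , inj₁ (hσ-arg Ms vV σ-step')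
...   | _ , β-step , inj₂ refl    = _ , hβ-arg Ms vV β-step , inj₂ refl

σ-postpone : ∀ {M L N} → M →hσ L → L →hβ* N → ∃[ L' ] (M →hβ* L' × (L' →hσ N ⊎ L' ≡ N))
σ-postpone σ-step ε = _ , ε , inj₁ σ-step
σ-postpone σ-step (β-step ◅ β-steps) with σβ-commute σ-step β-step
... | _ , β-step' , inj₂ refl = _ , β-step' ◅ β-steps , inj₂ refl
... | _ , β-step' , inj₁ σ-step' with σ-postpone σ-step' β-steps
...   | L' , β-steps' , rest = L' , β-step' ◅ β-steps' , rest

σ-optional⇒σ* : ∀ {M N} → (M →hσ N ⊎ M ≡ N) → M →hσ* N
σ-optional⇒σ* (inj₁ σ-step) = σ-step ◅ ε
σ-optional⇒σ* (inj₂ refl)   = ε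

-- Part (2): postpone the σ-steps one at a time, last one first.
σ*-postpone : ∀ {M L N} → M →hσ* L → L →hβ* N → ∃[ L' ] (M →hβ* L' × L' →hσ* N)
σ*-postpone ε β-steps = _ , β-steps , ε
σ*-postpone (σ-step ◅ σ-steps) β-steps with σ*-postpone σ-steps β-steps
... | _ , β-steps₁ , σ-steps₁ with σ-postpone σ-step β-steps₁
...   | L' , β-steps₂ , σ-rest = L' , β-steps₂ , σ-optional⇒σ* σ-rest ◅◅ σ-steps₁

-- Part (3): factorise the tail, then move a leading σ-step past its βv-part.
βσ-factorise : ∀ {M M'} → M →h* M' → ∃[ N ] (M →hβ* N × N →hσ* M')
βσ-factorise ε = _ , ε , ε
βσ-factorise (h-β β-step ◅ steps) with βσ-factorise steps
... | N , β-steps , σ-steps = N , β-step ◅ β-steps , σ-steps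
βσ-factorise (h-σ σ-step ◅ steps) with βσ-factorise steps
... | _ , β-steps , σ-steps with σ*-postpone (σ-step ◅ ε) β-steps
...   | N , β-steps' , σ-steps' = N , β-steps' , σ-steps' ◅◅ σ-steps

lemma3p11 : (∀ {M L N} → M →hσ L → L →hβ N → ∃[ L' ] (M →hβ L' × (L' →hσ N ⊎ L' ≡ N)))
    × (∀ {M L N} → M →hσ* L → L →hβ* N → ∃[ L' ] (M →hβ* L' × L' →hσ* N))
    × (∀ {M M'} → M →h* M' → ∃[ N ] (M →hβ* N × N →hσ* M'))
lemma3p11 = σβ-commute , σ*-postpone , βσ-factorise
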